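{- $\mathcal{H}^n=\operatorname{span}_{\mathbb{Z}/p\mathbb{Z}}\{x\mapsto\phi_\ell(\langle x,b\rangle):\ \ell\in[p^k],\ b\in\mathbb{P}R^{n-1}\}$, where for each direction $b$ a representative in $R^n$ (with at least one invertible coordinate) is used.
   Context: Let $p$ be prime, $k,n\in\mathbb{N}$, $R=\mathbb{Z}/p^k\mathbb{Z}$ with representatives $\{0,\dots,p^k-1\}$, $[m]=\{0,\dots,m-1\}$. For $\ell\in[p^k]$, $\phi_\ell:R\to\mathbb{Z}/p\mathbb{Z}$, $\phi_\ell(t)=\binom{t}{\ell}\bmod p$ (representative of $t$, $\binom{a}{b}=0$ for $a<b$). $\langle x,b\rangle=\sum_ix_ib_i\in R$. $\mathbb{P}R^{n-1}$ is the set of vectors of $R^n$ with at least one invertible coordinate, modulo $b\sim\lambda b$ for $\lambda\in R^\times$. $H_b(a)=\{x\in R^n:\langle x-a,b\rangle=0\text{ in }R\}$ for $a\in R^n$, $b\in\mathbb{P}R^{n-1}$. $\mathcal{H}^n$ is the $\mathbb{Z}/p\mathbb{Z}$-span of the indicator functions $\mathbf{1}_{H_b(a)}:R^n\to\mathbb{Z}/p\mathbb{Z}$. -}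

module Defs where

open import Data.Nat using (ℕ; zero; suc; _+_; _*_; _^_; _<_; NonZero)
open import Data.Nat.DivMod using (_%_)
open import Data.Nat.Properties using (m^n≢0; _≟_)
open import Data.Nat.Combinatorics using (_C_)
open import Data.Fin using (Fin; toℕ)
open import Data.List using (List; []; _∷_)
open import Data.Product using (Σ; ∃; _×_; _,_; proj₂)
open import Data.Bool using (if_then_else_)
open import Relation.Nullary using (does)
open import Relation.Binary.PropositionalEquality using (_≡_)
open import Function.Bundles using (_⇔_)

sumFin : (n : ℕ) → (Fin n → ℕ) → ℕ
sumFin zero    f = 0
sumFin (suc n) f = f Fin.zero + sumFin n (λ i → f (Fin.suc i))

module _ (p k : ℕ) {{nzp : NonZero p}} where

  -- the modulus q = p^k ; R = ℤ/p^kℤ is represented by Fin q (representatives 0..q-1)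
  q : ℕ
  q = p ^ k

  R : Set
  R = Fin q

  modq : ℕ → ℕ
  modq m = _%_ m q {{m^n≢0 p k}}

  -- reduction modulo p (values in ℤ/pℤ are naturals compared modulo p)
  modp : ℕ → ℕ
  modp m = m % p

  Invertible : R → Set
  Invertible c = Σ R λ d → modq (toℕ c * toℕ d) ≡ modq 1

  Vecⁿ : ℕ → Set
  Vecⁿ n = Fin n → R

  -- ⟨x,b⟩ ∈ R, returned as its representative in {0..p^k-1}
  ⟨_,_⟩ : {n : ℕ} → Vecⁿ n → Vecⁿ n → ℕ
  ⟨_,_⟩ {n} x b = modq (sumFin n (λ i → toℕ (x i) * toℕ (b i)))

  Admissible : {n : ℕ} → Vecⁿ n → Set
  Admissible {n} b = Σ (Fin n) λ i → Invertible (b i)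

  Associated : {n : ℕ} → Vecⁿ n → Vecⁿ n → Set
  Associated {n} b b' = Σ R λ u → Invertible u × ((i : Fin n) → toℕ (b' i) ≡ modq (toℕ u * toℕ (b i)))

  φ : ℕ → ℕ → ℕ
  φ ℓ t = modp (t C ℓ)

  -- H_b(a) = {x : ⟨x - a, b⟩ = 0}; equivalently ⟨x,b⟩ = ⟨a,b⟩ in R
  InH : {n : ℕ} → Vecⁿ n → Vecⁿ n → Vecⁿ n → Set
  InH x a b = ⟨ x , b ⟩ ≡ ⟨ a , b ⟩

  indH : {n : ℕ} → Vecⁿ n → Vecⁿ n → Vecⁿ n → ℕ
  indH x a b = if does (⟨ x , b ⟩ ≟ ⟨ a , b ⟩) then 1 else 0

  -- functions R^n → ℤ/pℤ (values read modulo p)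
  Fun : ℕ → Set
  Fun n = Vecⁿ n → ℕ

  evalLC : {n : ℕ} {P : Set} → (P → Fun n) → List (ℕ × P) → Fun n
  evalLC g []             x = 0
  evalLC g ((c , j) ∷ cs) x = c * g j x + evalLC g cs x

  InSpan : {n : ℕ} {P : Set} → (P → Fun n) → Fun n → Set
  InSpan g f = ∃ λ cs → ∀ x → modp (f x) ≡ modp (evalLC g cs x)

  SameSpan : {n : ℕ} {P Q : Set} → (P → Fun n) → (Q → Fun n) → Set
  SameSpan {n} g h = (f : Fun n) → InSpan g f ⇔ InSpan h f

  -- generators of 𝓗ⁿ : indices (a , b) with b ∈ ℙR^{n-1} (any representative)
  HParams : ℕ → Set
  HParams n = Σ (Vecⁿ n × Vecⁿ n) λ ab → Admissible (proj₂ ab)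

  Hgen : {n : ℕ} → HParams n → Fun n
  Hgen ((a , b) , _) x = indH x a b

  -- a choice of representative σ(b) for each direction [b] ∈ ℙR^{n-1}
  record RepChoice (n : ℕ) : Set where
    field
      σ        : Vecⁿ n → Vecⁿ n
      σ-assoc  : (b : Vecⁿ n) → Admissible b → Associated b (σ b)
      σ-const  : (b b' : Vecⁿ n) → Admissible b → Admissible b' → Associated b b' →
                 (i : Fin n) → σ b i ≡ σ b' i

  ΦParams : ℕ → Set
  ΦParams n = Σ ℕ λ ℓ → ℓ < q × Σ (Vecⁿ n) Admissible

  Φgen : {n : ℕ} → RepChoice n → ΦParams n → Fun n
  Φgen ρ (ℓ , _ , (b , _)) x = φ ℓ ⟨ x , RepChoice.σ ρ b ⟩

module Submission where

-- For a fixed admissible b, the map x ↦ ⟨ x , b ⟩ is onto R, and rescaling b by a unit only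
-- permutes its level sets; so both spans consist of combinations of functions x ↦ W ⟨ x , b ⟩.
-- Every such function is a combination of the indicators of hyperplanes H_b(a). It is also a
-- combination of the x ↦ φ_ℓ ⟨ x , b ⟩: the matrix (t C ℓ) over t, ℓ < p^k is unitriangular, so
-- the indicator of t = c equals t ↦ t C c minus a function supported on t > c, and downward
-- induction on c shows that the binomials t ↦ t C ℓ span all functions on [p^k] modulo p.

open import Defs

open import Algebra.Properties.CommutativeSemigroup using (x∙yz≈y∙xz)
open import Data.Bool using (if_then_else_)
open import Data.Empty using (⊥-elim)
open import Data.Fin using (Fin; toℕ; fromℕ<)
open import Data.Fin.Properties using (toℕ-fromℕ<)
open import Data.List using (List; []; _∷_; _++_)
open import Data.Nat using (ℕ; zero; suc; s≤s⁻¹; _+_; _*_; _∸_; _<_; _≤_; _<?_; NonZero; >-nonZero⁻¹)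
open import Data.Nat.Combinatorics using (_C_; nCn≡1; k>n⇒nCk≡0)
open import Data.Nat.DivMod using (_%_; %-distribˡ-+; %-distribˡ-*; m%n%n≡m%n; [m+kn]%n≡m%n; m%n<n; m<n⇒m%n≡m)
open import Data.Nat.Primality using (Prime; prime⇒nonZero)
open import Data.Nat.Properties
open import Data.Product using (Σ; ∃; _×_; _,_; proj₁)
open import Function using (_∘_)
open import Function.Bundles using (_⇔_; mk⇔; Equivalence)
open import Relation.Binary.PropositionalEquality
open import Relation.Nullary using (does; yes; no)
open import Relation.Nullary.Decidable using (dec-true; dec-false)

module ModularArithmetic (d : ℕ) {{_ : NonZero d}} where

  +-cong-mod : ∀ {a a′ b b′} → a % d ≡ a′ % d → b % d ≡ b′ % d → (a + b) % d ≡ (a′ + b′) % d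
  +-cong-mod {a} {a′} {b} {b′} a≡a′ b≡b′ = begin
    (a + b) % d                 ≡⟨ %-distribˡ-+ a b d ⟩
    (a % d + b % d) % d         ≡⟨ cong₂ (λ u v → (u + v) % d) a≡a′ b≡b′ ⟩
    (a′ % d + b′ % d) % d       ≡⟨ %-distribˡ-+ a′ b′ d ⟨
    (a′ + b′) % d               ∎
    where open ≡-Reasoning

  *-cong-mod : ∀ {a a′ b b′} → a % d ≡ a′ % d → b % d ≡ b′ % d → (a * b) % d ≡ (a′ * b′) % d
  *-cong-mod {a} {a′} {b} {b′} a≡a′ b≡b′ = begin
    (a * b) % d                 ≡⟨ %-distribˡ-* a b d ⟩
    (a % d * (b % d)) % d       ≡⟨ cong₂ (λ u v → (u * v) % d) a≡a′ b≡b′ ⟩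
    (a′ % d * (b′ % d)) % d     ≡⟨ %-distribˡ-* a′ b′ d ⟨
    (a′ * b′) % d               ∎
    where open ≡-Reasoning

  sumFin-cong-mod : ∀ n {f g : Fin n → ℕ} → (∀ i → f i % d ≡ g i % d) → sumFin n f % d ≡ sumFin n g % d
  sumFin-cong-mod zero    f≡g = refl
  sumFin-cong-mod (suc n) f≡g = +-cong-mod (f≡g Fin.zero) (sumFin-cong-mod n (f≡g ∘ Fin.suc))

sumFin-*ˡ : ∀ n u (f : Fin n → ℕ) → sumFin n (λ i → u * f i) ≡ u * sumFin n f
sumFin-*ˡ zero    u f = sym (*-zeroʳ u)
sumFin-*ˡ (suc n) u f =
  trans (cong (u * f Fin.zero +_) (sumFin-*ˡ n u (f ∘ Fin.suc))) (sym (*-distribˡ-+ u (f Fin.zero) _))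

sumFin-zero : ∀ n (f : Fin n → ℕ) → (∀ i → f i ≡ 0) → sumFin n f ≡ 0
sumFin-zero zero    f f≡0 = refl
sumFin-zero (suc n) f f≡0 = cong₂ _+_ (f≡0 Fin.zero) (sumFin-zero n (f ∘ Fin.suc) (f≡0 ∘ Fin.suc))

-- Argument order chosen so that indH x a b is definitionally δ ⟨ a , b ⟩ ⟨ x , b ⟩.
δ : ℕ → ℕ → ℕ
δ c t = if does (t ≟ c) then 1 else 0

δ-diag : ∀ {c t} → t ≡ c → δ c t ≡ 1
δ-diag {c} {t} t≡c = cong (if_then 1 else 0) (dec-true (t ≟ c) t≡c)

δ-off : ∀ {c t} → t ≢ c → δ c t ≡ 0
δ-off {c} {t} t≢c = cong (if_then 1 else 0) (dec-false (t ≟ c) t≢c)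

δ-cong : ∀ {c t c′ t′} → (t ≡ c ⇔ t′ ≡ c′) → δ c t ≡ δ c′ t′
δ-cong {c} {t} iff with t ≟ c
... | yes t≡c = trans (δ-diag t≡c) (sym (δ-diag (Equivalence.to iff t≡c)))
... | no  t≢c = trans (δ-off t≢c) (sym (δ-off (t≢c ∘ Equivalence.from iff)))

zeroAt : ℕ → (ℕ → ℕ) → ℕ → ℕ
zeroAt c F t = if does (t ≟ c) then 0 else F t

zeroAt-diag : ∀ c F → zeroAt c F c ≡ 0
zeroAt-diag c F = cong (if_then 0 else F c) (dec-true (c ≟ c) refl)

zeroAt-off : ∀ {c t} F → t ≢ c → zeroAt c F t ≡ F t
zeroAt-off {c} {t} F t≢c = cong (if_then 0 else F t) (dec-false (t ≟ c) t≢c)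

δ-decomposition : ∀ F c t → F c * δ c t + zeroAt c F t ≡ F t
δ-decomposition F c t with t ≟ c
... | yes refl = begin
  F t * δ t t + zeroAt t F t  ≡⟨ cong₂ (λ u v → F t * u + v) (δ-diag {t} refl) (zeroAt-diag t F) ⟩
  F t * 1 + 0                 ≡⟨ trans (+-identityʳ _) (*-identityʳ (F t)) ⟩
  F t                         ∎
  where open ≡-Reasoning
... | no  t≢c = trans (cong₂ (λ u v → F c * u + v) (δ-off t≢c) (zeroAt-off F t≢c))
                      (cong (_+ F t) (*-zeroʳ (F c)))

zeroAt-vanishing : ∀ {c} F → (∀ t → t < c → F t ≡ 0) → ∀ t → t < suc c → zeroAt c F t ≡ 0
zeroAt-vanishing {c} F F<c≡0 t t<1+c with t ≟ c
... | yes refl = zeroAt-diag t F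
... | no  t≢c  = trans (zeroAt-off F t≢c) (F<c≡0 t (≤∧≢⇒< (s≤s⁻¹ t<1+c) t≢c))

module Span (p : ℕ) {{_ : NonZero p}} where
  open ModularArithmetic p

  combination : {X P : Set} → (P → X → ℕ) → List (ℕ × P) → X → ℕ
  combination g []             x = 0
  combination g ((c , j) ∷ cs) x = c * g j x + combination g cs x

  infix 4 _∈Span_
  _∈Span_ : {X P : Set} → (X → ℕ) → (P → X → ℕ) → Set
  f ∈Span g = ∃ λ cs → ∀ x → f x % p ≡ combination g cs x % p

  module _ {X P : Set} {g : P → X → ℕ} where

    combination-++ : ∀ cs ds x → combination g (cs ++ ds) x ≡ combination g cs x + combination g ds x
    combination-++ []             ds x = refl
    combination-++ ((c , j) ∷ cs) ds x =
      trans (cong (c * g j x +_) (combination-++ cs ds x)) (sym (+-assoc (c * g j x) _ _))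

    scale : ℕ → List (ℕ × P) → List (ℕ × P)
    scale a []             = []
    scale a ((c , j) ∷ cs) = (a * c , j) ∷ scale a cs

    combination-scale : ∀ a cs x → combination g (scale a cs) x ≡ a * combination g cs x
    combination-scale a []             x = sym (*-zeroʳ a)
    combination-scale a ((c , j) ∷ cs) x =
      trans (cong₂ _+_ (*-assoc a c (g j x)) (combination-scale a cs x))
            (sym (*-distribˡ-+ a (c * g j x) (combination g cs x)))

    vanishing∈Span : ∀ {f} → (∀ x → f x ≡ 0) → f ∈Span g
    vanishing∈Span f≡0 = [] , λ x → cong (_% p) (f≡0 x)

    generator∈Span : ∀ j → g j ∈Span g
    generator∈Span j = (1 , j) ∷ [] , λ x → cong (_% p) (sym (trans (+-identityʳ _) (*-identityˡ _)))

    ∈Span-resp : ∀ {f f′} → (∀ x → f′ x % p ≡ f x % p) → f ∈Span g → f′ ∈Span g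
    ∈Span-resp f′≡f (cs , f≡) = cs , λ x → trans (f′≡f x) (f≡ x)

    +-∈Span : ∀ {f f′} → f ∈Span g → f′ ∈Span g → (λ x → f x + f′ x) ∈Span g
    +-∈Span (cs , f≡) (ds , f′≡) = cs ++ ds , λ x →
      trans (+-cong-mod (f≡ x) (f′≡ x)) (cong (_% p) (sym (combination-++ cs ds x)))

    *-∈Span : ∀ {f} a → f ∈Span g → (λ x → a * f x) ∈Span g
    *-∈Span a (cs , f≡) = scale a cs , λ x →
      trans (*-cong-mod {a} refl (f≡ x)) (cong (_% p) (sym (combination-scale a cs x)))

    -- −1 is represented by p ∸ 1.
    difference∈Span : ∀ {f h f′} → (∀ x → f x + h x ≡ f′ x) → h ∈Span g → f′ ∈Span g → f ∈Span g
    difference∈Span {f} {h} {f′} f+h≡f′ h∈ f′∈ = ∈Span-resp f≡f′-h (+-∈Span f′∈ (*-∈Span (p ∸ 1) h∈))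
      where
        f≡f′-h : ∀ x → f x % p ≡ (f′ x + (p ∸ 1) * h x) % p
        f≡f′-h x = sym (begin
          (f′ x + (p ∸ 1) * h x) % p        ≡⟨ cong (λ y → (y + (p ∸ 1) * h x) % p) (f+h≡f′ x) ⟨
          (f x + h x + (p ∸ 1) * h x) % p   ≡⟨ cong (_% p) (+-assoc (f x) (h x) _) ⟩
          (f x + (1 + (p ∸ 1)) * h x) % p   ≡⟨ cong (λ m → (f x + m * h x) % p) (m+[n∸m]≡n (>-nonZero⁻¹ p)) ⟩
          (f x + p * h x) % p               ≡⟨ cong (λ m → (f x + m) % p) (*-comm p (h x)) ⟩
          (f x + h x * p) % p               ≡⟨ [m+kn]%n≡m%n (f x) (h x) p ⟩
          f x % p                           ∎)
          where open ≡-Reasoning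

  ∈Span-trans : ∀ {X P Q : Set} {g : P → X → ℕ} {h : Q → X → ℕ} {f} →
    (∀ j → g j ∈Span h) → f ∈Span g → f ∈Span h
  ∈Span-trans {g = g} {h} g⊆h (cs , f≡) = ∈Span-resp f≡ (combination∈Span cs)
    where
      combination∈Span : ∀ cs → combination g cs ∈Span h
      combination∈Span []             = vanishing∈Span (λ _ → refl)
      combination∈Span ((c , j) ∷ cs) = +-∈Span (*-∈Span c (g⊆h j)) (combination∈Span cs)

  ∈Span-∘ : ∀ {X Y P : Set} {g : P → X → ℕ} {f} (π : Y → X) → f ∈Span g → (f ∘ π) ∈Span (λ j → g j ∘ π)
  ∈Span-∘ {g = g} π (cs , f≡) = cs , λ y → trans (f≡ (π y)) (cong (_% p) (combination-∘ cs y))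
    where
      combination-∘ : ∀ cs y → combination g cs (π y) ≡ combination (λ j → g j ∘ π) cs y
      combination-∘ []             y = refl
      combination-∘ ((c , j) ∷ cs) y = cong (c * g j (π y) +_) (combination-∘ cs y)

module BinomialBasis (p : ℕ) {{_ : NonZero p}} (q : ℕ) where
  open Span p

  Below : Set
  Below = Σ ℕ (_< q)

  binomial : Below → Below → ℕ
  binomial (ℓ , _) (t , _) = (t C ℓ) % p

  private
    q≤d+1+c : ∀ {d c} → q ≤ suc d + c → q ≤ d + suc c
    q≤d+1+c {d} {c} = subst (q ≤_) (sym (+-suc d c))

  vanishing-below∈Span : ∀ {P} (g : P → Below → ℕ) d c → q ≤ d + c →
    (∀ j → c ≤ j → j < q → (δ j ∘ proj₁) ∈Span g) →
    ∀ F → (∀ t → t < c → F t ≡ 0) → (F ∘ proj₁) ∈Span g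
  vanishing-below∈Span g d c q≤d+c δ∈ F F<c≡0 with c <? q
  ... | no c≮q = vanishing∈Span (λ (t , t<q) → F<c≡0 t (<-≤-trans t<q (≮⇒≥ c≮q)))
  vanishing-below∈Span g zero c q≤c δ∈ F F<c≡0 | yes c<q = ⊥-elim (<⇒≱ c<q q≤c)
  vanishing-below∈Span g (suc d) c q≤d+c δ∈ F F<c≡0 | yes c<q =
    ∈Span-resp (λ (t , _) → cong (_% p) (sym (δ-decomposition F c t)))
      (+-∈Span (*-∈Span (F c) (δ∈ c ≤-refl c<q))
               (vanishing-below∈Span g d (suc c) (q≤d+1+c q≤d+c)
                 (λ j c<j → δ∈ j (<⇒≤ c<j)) (zeroAt c F) (zeroAt-vanishing F F<c≡0)))

  δ∈Span-binomial : ∀ d c → q ≤ d + c → ∀ j → c ≤ j → j < q → (δ j ∘ proj₁) ∈Span binomial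
  δ∈Span-binomial zero    c q≤c j c≤j j<q = ⊥-elim (<⇒≱ j<q (≤-trans q≤c c≤j))
  δ∈Span-binomial (suc d) c q≤d+c j c≤j j<q with c ≟ j
  ... | no c≢j  = δ∈Span-binomial d (suc c) (q≤d+1+c q≤d+c) j (≤∧≢⇒< c≤j c≢j) j<q
  ... | yes refl =
    difference∈Span δ+zeroAt≡C
      (vanishing-below∈Span binomial d (suc c) (q≤d+1+c q≤d+c) (δ∈Span-binomial d (suc c) (q≤d+1+c q≤d+c))
        (zeroAt c (_C c)) (zeroAt-vanishing (_C c) (λ t t<c → k>n⇒nCk≡0 t<c)))
      (∈Span-resp (λ (t , _) → sym (m%n%n≡m%n (t C c) p)) (generator∈Span (c , j<q)))
    where
      δ+zeroAt≡C : ∀ ((t , _) : Below) → δ c t + zeroAt c (_C c) t ≡ t C c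
      δ+zeroAt≡C (t , _) = begin
        δ c t + zeroAt c (_C c) t             ≡⟨ cong (_+ zeroAt c (_C c) t) (*-identityˡ (δ c t)) ⟨
        1 * δ c t + zeroAt c (_C c) t         ≡⟨ cong (λ m → m * δ c t + zeroAt c (_C c) t) (nCn≡1 c) ⟨
        (c C c) * δ c t + zeroAt c (_C c) t   ≡⟨ δ-decomposition (_C c) c t ⟩
        t C c                                 ∎
        where open ≡-Reasoning

  binomials-span : ∀ F → (F ∘ proj₁) ∈Span binomial
  binomials-span F =
    vanishing-below∈Span binomial q 0 (m≤m+n q 0) (δ∈Span-binomial q 0 (m≤m+n q 0)) F (λ _ ())

  deltas-span : ∀ F → (F ∘ proj₁) ∈Span (λ ((c , _) : Below) → δ c ∘ proj₁)
  deltas-span F =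
    vanishing-below∈Span _ q 0 (m≤m+n q 0) (λ j _ j<q → generator∈Span (j , j<q)) F (λ _ ())

module Hyperplanes (p k : ℕ) {{_ : NonZero p}} where
  open Span p

  Q : ℕ
  Q = q p k

  private instance
    Q≢0 : NonZero Q
    Q≢0 = m^n≢0 p k

  open ModularArithmetic Q
  open BinomialBasis p Q

  ⟪_,_⟫ : ∀ {n} → Vecⁿ p k n → Vecⁿ p k n → ℕ
  ⟪ x , b ⟫ = ⟨_,_⟩ p k x b

  ⟪⟫<Q : ∀ {n} (x b : Vecⁿ p k n) → ⟪ x , b ⟫ < Q
  ⟪⟫<Q {n} x b = m%n<n (sumFin n (λ i → toℕ (x i) * toℕ (b i))) Q

  ⟪⟫-scale : ∀ {n} {b s : Vecⁿ p k n} u → (∀ i → toℕ (s i) ≡ (u * toℕ (b i)) % Q) →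
    ∀ x → ⟪ x , s ⟫ ≡ (u * ⟪ x , b ⟫) % Q
  ⟪⟫-scale {n} {b} {s} u s≡ub x = begin
    sumFin n (λ i → xᵢ i * toℕ (s i)) % Q        ≡⟨ sumFin-cong-mod n termwise ⟩
    sumFin n (λ i → u * (xᵢ i * toℕ (b i))) % Q  ≡⟨ cong (_% Q) (sumFin-*ˡ n u _) ⟩
    (u * sumFin n (λ i → xᵢ i * toℕ (b i))) % Q  ≡⟨ *-cong-mod {u} refl (m%n%n≡m%n _ Q) ⟨
    (u * ⟪ x , b ⟫) % Q                         ∎
    where
      open ≡-Reasoning
      xᵢ : Fin n → ℕ
      xᵢ i = toℕ (x i)
      termwise : ∀ i → (xᵢ i * toℕ (s i)) % Q ≡ (u * (xᵢ i * toℕ (b i))) % Q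
      termwise i = trans (*-cong-mod {xᵢ i} refl (trans (cong (_% Q) (s≡ub i)) (m%n%n≡m%n _ Q)))
                         (cong (_% Q) (x∙yz≈y∙xz *-commutativeSemigroup (xᵢ i) u (toℕ (b i))))

  unit-cancel : ∀ {u v X Y} → (u * v) % Q ≡ 1 % Q → X < Q → Y < Q → (u * X) % Q ≡ (u * Y) % Q → X ≡ Y
  unit-cancel {u} {v} {X} {Y} uv≡1 X<Q Y<Q uX≡uY = begin
    X                        ≡⟨ m<n⇒m%n≡m X<Q ⟨
    X % Q                    ≡⟨ multiply-back X ⟩
    (v * ((u * X) % Q)) % Q  ≡⟨ cong (λ z → (v * z) % Q) uX≡uY ⟩
    (v * ((u * Y) % Q)) % Q  ≡⟨ multiply-back Y ⟨
    Y % Q                    ≡⟨ m<n⇒m%n≡m Y<Q ⟩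
    Y                        ∎
    where
      open ≡-Reasoning
      multiply-back : ∀ Z → Z % Q ≡ (v * ((u * Z) % Q)) % Q
      multiply-back Z = begin
        Z % Q                    ≡⟨ cong (_% Q) (*-identityˡ Z) ⟨
        (1 * Z) % Q              ≡⟨ *-cong-mod {1} {u * v} (sym uv≡1) refl ⟩
        (u * v * Z) % Q          ≡⟨ cong (λ w → (w * Z) % Q) (*-comm u v) ⟩
        (v * u * Z) % Q          ≡⟨ cong (_% Q) (*-assoc v u Z) ⟩
        (v * (u * Z)) % Q        ≡⟨ *-cong-mod {v} refl (m%n%n≡m%n (u * Z) Q) ⟨
        (v * ((u * Z) % Q)) % Q  ∎

  associated-hyperplanes : ∀ {n} {b s : Vecⁿ p k n} → Associated p k b s →
    ∀ x a → ⟪ x , b ⟫ ≡ ⟪ a , b ⟫ ⇔ ⟪ x , s ⟫ ≡ ⟪ a , s ⟫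
  associated-hyperplanes {b = b} {s} (u , (v , uv≡1) , s≡ub) x a = mk⇔
    (λ bx≡ba → trans (⟪⟫-scale (toℕ u) s≡ub x)
                 (trans (cong (λ z → (toℕ u * z) % Q) bx≡ba) (sym (⟪⟫-scale (toℕ u) s≡ub a))))
    (λ sx≡sa → unit-cancel {toℕ u} uv≡1 (⟪⟫<Q x b) (⟪⟫<Q a b)
                 (trans (sym (⟪⟫-scale (toℕ u) s≡ub x)) (trans sx≡sa (⟪⟫-scale (toℕ u) s≡ub a))))

  0R : R p k
  0R = fromℕ< (>-nonZero⁻¹ Q)

  toℕ-0R : toℕ 0R ≡ 0
  toℕ-0R = toℕ-fromℕ< (>-nonZero⁻¹ Q)

  single : ∀ {n} → Fin n → R p k → Vecⁿ p k n
  single Fin.zero    v Fin.zero    = v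
  single Fin.zero    v (Fin.suc _) = 0R
  single (Fin.suc i) v Fin.zero    = 0R
  single (Fin.suc i) v (Fin.suc j) = single i v j

  sumFin-single : ∀ {n} i v (b : Vecⁿ p k n) →
    sumFin n (λ j → toℕ (single i v j) * toℕ (b j)) ≡ toℕ v * toℕ (b i)
  sumFin-single {suc n} Fin.zero v b =
    trans (cong (toℕ v * toℕ (b Fin.zero) +_)
                (sumFin-zero n _ (λ j → cong (_* toℕ (b (Fin.suc j))) toℕ-0R)))
          (+-identityʳ _)
  sumFin-single {suc n} (Fin.suc i) v b =
    trans (cong (λ z → z * toℕ (b Fin.zero) + sumFin n (λ j → toℕ (single i v j) * toℕ (b (Fin.suc j))))
                toℕ-0R)
          (sumFin-single i v (b ∘ Fin.suc))

  ⟪⟫-surjective : ∀ {n} {b : Vecⁿ p k n} → Admissible p k b → ∀ {c} → c < Q →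
    Σ (Vecⁿ p k n) λ a → ⟪ a , b ⟫ ≡ c
  ⟪⟫-surjective {n} {b} (i , e , bᵢe≡1) {c} c<Q = single i v , (begin
    sumFin n (λ j → toℕ (single i v j) * toℕ (b j)) % Q  ≡⟨ cong (_% Q) (sumFin-single i v b) ⟩
    (toℕ v * toℕ (b i)) % Q                             ≡⟨ *-cong-mod (cong (_% Q) toℕ-v) refl ⟩
    ((c * toℕ e) % Q * toℕ (b i)) % Q                   ≡⟨ *-cong-mod (m%n%n≡m%n (c * toℕ e) Q) refl ⟩
    (c * toℕ e * toℕ (b i)) % Q                         ≡⟨ cong (_% Q) (*-assoc c _ _) ⟩
    (c * (toℕ e * toℕ (b i))) % Q                       ≡⟨ *-cong-mod {c} refl eᵢbᵢ≡1 ⟩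
    (c * 1) % Q                                         ≡⟨ cong (_% Q) (*-identityʳ c) ⟩
    c % Q                                               ≡⟨ m<n⇒m%n≡m c<Q ⟩
    c                                                   ∎)
    where
      open ≡-Reasoning
      v : R p k
      v = fromℕ< (m%n<n (c * toℕ e) Q)
      toℕ-v : toℕ v ≡ (c * toℕ e) % Q
      toℕ-v = toℕ-fromℕ< (m%n<n (c * toℕ e) Q)
      eᵢbᵢ≡1 : (toℕ e * toℕ (b i)) % Q ≡ 1 % Q
      eᵢbᵢ≡1 = trans (cong (_% Q) (*-comm (toℕ e) (toℕ (b i)))) bᵢe≡1

  module _ {n : ℕ} (ρ : RepChoice p k n) where
    open RepChoice ρ

    hyperplane∈Span-Φgen : ∀ j → Hgen p k j ∈Span Φgen p k ρ
    hyperplane∈Span-Φgen ((a , b) , adm) =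
      ∈Span-resp (λ x → cong (_% p) (δ-cong (associated-hyperplanes (σ-assoc b adm) x a)))
        (∈Span-trans (λ (ℓ , ℓ<Q) → generator∈Span (ℓ , ℓ<Q , b , adm))
          (∈Span-∘ (λ x → ⟪ x , σ b ⟫ , ⟪⟫<Q x (σ b)) (binomials-span (δ ⟪ a , σ b ⟫))))

    Φgen∈Span-hyperplanes : ∀ j → Φgen p k ρ j ∈Span Hgen p k
    Φgen∈Span-hyperplanes (ℓ , _ , b , adm) with σ-assoc b adm
    ... | u , _ , s≡ub =
      ∈Span-resp (λ x → trans (m%n%n≡m%n _ p) (cong (λ t → (t C ℓ) % p) (⟪⟫-scale (toℕ u) s≡ub x)))
        (∈Span-trans level-set∈Span (∈Span-∘ (λ x → ⟪ x , b ⟫ , ⟪⟫<Q x b) (deltas-span W)))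
      where
        W : ℕ → ℕ
        W c = ((toℕ u * c) % Q) C ℓ
        level-set∈Span : ∀ ((c , _) : Below) → (λ x → δ c ⟪ x , b ⟫) ∈Span Hgen p k
        level-set∈Span (c , c<Q) with ⟪⟫-surjective adm c<Q
        ... | a , ⟪a,b⟫≡c = ∈Span-resp (λ x → cong (λ c → δ c ⟪ x , b ⟫ % p) (sym ⟪a,b⟫≡c))
                                       (generator∈Span ((a , b) , adm))

  evalLC≡combination : ∀ {n P} (g : P → Fun p k n) cs x → evalLC p k g cs x ≡ combination g cs x
  evalLC≡combination g []             x = refl
  evalLC≡combination g ((c , j) ∷ cs) x = cong (c * g j x +_) (evalLC≡combination g cs x)

  InSpan⇔∈Span : ∀ {n P} {g : P → Fun p k n} {f} → InSpan p k g f ⇔ f ∈Span g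
  InSpan⇔∈Span {g = g} = mk⇔
    (λ (cs , f≡) → cs , λ x → trans (f≡ x) (cong (_% p) (evalLC≡combination g cs x)))
    (λ (cs , f≡) → cs , λ x → trans (f≡ x) (cong (_% p) (sym (evalLC≡combination g cs x))))

  sameSpan : ∀ {n P P′} {g : P → Fun p k n} {h : P′ → Fun p k n} →
    (∀ j → g j ∈Span h) → (∀ j → h j ∈Span g) → SameSpan p k g h
  sameSpan g⊆h h⊆g f = mk⇔
    (λ f∈g → from InSpan⇔∈Span (∈Span-trans g⊆h (to InSpan⇔∈Span f∈g)))
    (λ f∈h → from InSpan⇔∈Span (∈Span-trans h⊆g (to InSpan⇔∈Span f∈h)))
    where open Equivalence

lemma5p8 : (p k n : ℕ) → (pr : Prime p) → (ρ : RepChoice p k {{prime⇒nonZero pr}} n) →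
    SameSpan p k {{prime⇒nonZero pr}} (Hgen p k {{prime⇒nonZero pr}})
    (Φgen p k {{prime⇒nonZero pr}} ρ)
lemma5p8 p k n pr ρ =
  sameSpan (hyperplane∈Span-Φgen ρ) (Φgen∈Span-hyperplanes ρ)
  where open Hyperplanes p k {{prime⇒nonZero pr}}
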